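{- Let $p\ge 1$, $t\ge 1$, and for $i=1,\dots,t$ let $B_i$ be a $k_i$-rowed simple matrix with $B_i\in\mathrm{Avoid}(k_i,F(0,p,1,0))$ such that $B_i$ has no column of all 1's (it may have a column of all 0's). Partition $m=\sum_{i=1}^t k_i$ rows into consecutive blocks $C_1,\dots,C_t$ with $|C_i|=k_i$, and let $A$ be the $m$-rowed matrix consisting of $t+1$ column blocks: for $j=1,\dots,t$, the $j$-th column block has $B_j$ on rows $C_j$, all 1's on rows $C_\ell$ for $\ell<j$, and all 0's on rows $C_\ell$ for $\ell>j$; the last column block is a single column of all 1's. Then $A\in\mathrm{Avoid}(m,F(0,p,1,0))$ and $A$ has $1+\sum_{i=1}^t \|B_i\|$ columns, where $\|B_i\|$ denotes the number of columns of $B_i$.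
   Context: A matrix is simple if it is a $(0,1)$-matrix with no repeated columns. $F\prec A$ means some submatrix of $A$ is a row and column permutation of $F$. $\mathrm{Avoid}(m,F)$ is the set of simple $m$-rowed matrices $A$ with $F\not\prec A$. $F(0,p,1,0)$ is the $2\times(p+1)$ matrix with $p$ columns $\binom{1}{0}$ and one column $\binom{0}{1}$. -}

module Defs where

open import Data.Nat using (ℕ; zero; suc; _+_)
open import Data.Bool using (Bool; true; false)
open import Data.Fin using (Fin; zero; suc)
open import Data.List using (List; []; _∷_; length; map; replicate; _++_)
import Data.List as List
open import Data.Vec using (Vec) renaming (_++_ to _++ᵥ_; replicate to replicateᵥ; lookup to lookupᵥ)
open import Data.Product using (Σ; _×_)
open import Function.Definitions using (Injective)
open import Relation.Binary.PropositionalEquality using (_≡_)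
open import Relation.Nullary using (¬_)
open import Data.List.Relation.Unary.Unique.Propositional using (Unique)

-- An m-rowed (0,1)-matrix, given as its ordered list of columns.
Mat : ℕ → Set
Mat m = List (Vec Bool m)

cols : ∀ {m} → Mat m → ℕ
cols A = length A

entry : ∀ {m} (A : Mat m) → Fin m → Fin (length A) → Bool
entry A r c = lookupᵥ (List.lookup A c) r

Simple : ∀ {m} → Mat m → Set
Simple A = Unique A

-- F ≺ A : some submatrix of A is a row and column permutation of F,
-- i.e. injective row and column selections realizing F.
_≺_ : ∀ {k m} → Mat k → Mat m → Set
_≺_ {k} {m} F A =
  Σ (Fin k → Fin m) λ ρ → Injective _≡_ _≡_ ρ ×
  Σ (Fin (length F) → Fin (length A)) λ γ → Injective _≡_ _≡_ γ ×
  (∀ i j → entry A (ρ i) (γ j) ≡ entry F i j)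

Avoid : ∀ {k} (m : ℕ) → Mat k → Mat m → Set
Avoid m F A = Simple A × ¬ (F ≺ A)

F0p10 : ℕ → Mat 2
F0p10 p = replicate p (true Vec.∷ false Vec.∷ Vec.[]) ++ ((false Vec.∷ true Vec.∷ Vec.[]) ∷ [])
  where import Data.Vec as Vec

∑ : (t : ℕ) → (Fin t → ℕ) → ℕ
∑ zero f = 0
∑ (suc t) f = f zero + ∑ t (λ i → f (suc i))

-- Unfolding, the j-th column
-- block has B_j on C_j, 1's on C_ℓ (ℓ<j), 0's on C_ℓ (ℓ>j), followed by
-- one all-1's column.
construct : (t : ℕ) (k : Fin t → ℕ) (B : (i : Fin t) → Mat (k i)) → Mat (∑ t k)
construct zero k B = Vec.[] ∷ []
  where import Data.Vec as Vec
construct (suc t) k B =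
  map (λ c → c ++ᵥ replicateᵥ (∑ t (λ i → k (suc i))) false) (B zero)
  ++ map (λ c → replicateᵥ (k zero) true ++ᵥ c) (construct t (λ i → k (suc i)) (λ i → B (suc i)))

{-# OPTIONS --safe #-}
-- construct (suc t) k B is the block matrix [ B₁ 0 ; 1 A′ ] with A′ built from
-- B₂, …, B_t, so by induction it suffices to show that an occurrence of F = F(0,p,1,0) in it
-- lies inside B₁ or inside A′.  If the two rows of the occurrence lie in different row blocks,
-- this fails: every upper row dominates every lower row entrywise, while F has both a (1,0)
-- and a (0,1) column.  If both rows lie in the upper block, no column of F can come from the
-- right-hand columns, which are constant 1 there, as F has no constant column; dually for the
-- lower block and the constant 0 columns.  Simplicity survives stacking because a column
-- (b over 0) can equal a column (1 over d) only if b is all 1's.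
module Submission where

open import Defs
open import Data.Nat using (ℕ; zero; suc; _+_; _≥_)
open import Data.Nat.Properties using (+-suc)
open import Data.Bool using (Bool; true; false; _≤_)
open import Data.Bool.Properties using (≤-minimum; ≤-maximum)
open import Data.Fin using (Fin; zero; suc; splitAt; join; cast; toℕ)
open import Data.Fin.Properties using (join-splitAt; toℕ-cast; toℕ-injective; cast-is-id)
open import Data.Product using (∃; _×_; _,_; proj₁; proj₂)
import Data.Product as Product
open import Data.Sum using (_⊎_; inj₁; inj₂; [_,_]′)
import Data.Sum as Sum
open import Data.Sum.Properties using (inj₁-injective; inj₂-injective; [,]-map)
open import Data.Vec using (Vec; replicate) renaming (_++_ to _++ᵥ_; lookup to lookupᵥ)
open import Data.Vec.Properties using (lookup-splitAt; lookup-replicate; ++-injectiveˡ; ++-injectiveʳ)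
open import Data.List using (List; []; _∷_; length; map; _++_; lookup)
open import Data.List.Properties using (length-++; length-map)
open import Data.List.Membership.Propositional using (_∈_)
open import Data.List.Membership.Propositional.Properties using (∈-map⁻)
open import Data.List.Relation.Unary.Unique.Propositional.Properties using (++⁺; map⁺)
import Data.List.Relation.Unary.All as All
import Data.List.Relation.Unary.AllPairs as AllPairs
open import Data.Empty using (⊥-elim)
open import Function using (_∘_; id; flip)
open import Function.Definitions using (Injective)
import Function.Construct.Composition as Composition
open import Relation.Nullary using (¬_)
open import Relation.Binary.PropositionalEquality
  using (_≡_; _≢_; refl; sym; trans; cong; cong₂; subst₂; module ≡-Reasoning)

open ≡-Reasoning

cast-injective : ∀ {m n} .(eq : m ≡ n) → Injective _≡_ _≡_ (cast eq)
cast-injective eq {i} {j} h = toℕ-injective (begin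
  toℕ i            ≡⟨ toℕ-cast eq i ⟨
  toℕ (cast eq i)  ≡⟨ cong toℕ h ⟩
  toℕ (cast eq j)  ≡⟨ toℕ-cast eq j ⟩
  toℕ j            ∎)

splitAt-injective : ∀ m {n} → Injective _≡_ _≡_ (splitAt m {n})
splitAt-injective m {n} {i} {j} h = begin
  i                      ≡⟨ join-splitAt m n i ⟨
  join m n (splitAt m i) ≡⟨ cong (join m n) h ⟩
  join m n (splitAt m j) ≡⟨ join-splitAt m n j ⟩
  j                      ∎

⊎-map-injective : ∀ {A B C D : Set} {f : A → C} {g : B → D} →
  Injective _≡_ _≡_ f → Injective _≡_ _≡_ g → Injective _≡_ _≡_ (Sum.map f g)
⊎-map-injective f-inj g-inj {inj₁ x} {inj₁ y} h = cong inj₁ (f-inj (inj₁-injective h))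
⊎-map-injective f-inj g-inj {inj₂ x} {inj₂ y} h = cong inj₂ (g-inj (inj₂-injective h))
⊎-map-injective f-inj g-inj {inj₁ x} {inj₂ y} ()
⊎-map-injective f-inj g-inj {inj₂ x} {inj₁ y} ()

module _ {A : Set} where

  ++-index : (xs ys : List A) → Fin (length (xs ++ ys)) → Fin (length xs) ⊎ Fin (length ys)
  ++-index xs ys = splitAt (length xs) ∘ cast (length-++ xs)

  ++-index-injective : ∀ xs ys → Injective _≡_ _≡_ (++-index xs ys)
  ++-index-injective xs ys =
    Composition.injective _≡_ _≡_ _≡_ (cast-injective (length-++ xs)) (splitAt-injective (length xs))

  lookup-++ : ∀ xs ys i → lookup (xs ++ ys) i ≡ [ lookup xs , lookup ys ]′ (++-index xs ys i)
  lookup-++ []       ys i       = cong (lookup ys) (sym (cast-is-id refl i))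
  lookup-++ (x ∷ xs) ys zero    = refl
  lookup-++ (x ∷ xs) ys (suc i) = trans (lookup-++ xs ys i) (sym ([,]-map (++-index xs ys i)))

  lookup-map : ∀ {B : Set} (f : A → B) xs i → lookup (map f xs) i ≡ f (lookup xs (cast (length-map f xs) i))
  lookup-map f (x ∷ xs) zero    = refl
  lookup-map f (x ∷ xs) (suc i) = lookup-map f xs i

module _ {k n : ℕ} (B : Mat k) (D : Mat n) where

  zeros-below : Vec Bool k → Vec Bool (k + n)
  zeros-below c = c ++ᵥ replicate n false

  ones-above : Vec Bool n → Vec Bool (k + n)
  ones-above c = replicate k true ++ᵥ c

  B-columns : Mat (k + n)
  B-columns = map zeros-below B

  D-columns : Mat (k + n)
  D-columns = map ones-above D

  stack : Mat (k + n)
  stack = B-columns ++ D-columns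

  unmap-index : Fin (cols B-columns) ⊎ Fin (cols D-columns) → Fin (cols B) ⊎ Fin (cols D)
  unmap-index = Sum.map (cast (length-map zeros-below B)) (cast (length-map ones-above D))

  stack-column : Fin (cols stack) → Fin (cols B) ⊎ Fin (cols D)
  stack-column c = unmap-index (++-index B-columns D-columns c)

  stack-column-injective : Injective _≡_ _≡_ stack-column
  stack-column-injective = Composition.injective _≡_ _≡_ _≡_ (++-index-injective B-columns D-columns)
    (⊎-map-injective (cast-injective (length-map zeros-below B)) (cast-injective (length-map ones-above D)))

  block-entry : Fin k ⊎ Fin n → Fin (cols B) ⊎ Fin (cols D) → Bool
  block-entry (inj₁ u) (inj₁ a) = entry B u a
  block-entry (inj₂ v) (inj₁ a) = false
  block-entry (inj₁ u) (inj₂ b) = true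
  block-entry (inj₂ v) (inj₂ b) = entry D v b

  stack-entry : ∀ r c → entry stack r c ≡ block-entry (splitAt k r) (stack-column c)
  stack-entry r c = trans (cong (flip lookupᵥ r) (lookup-++ B-columns D-columns c))
                          (column-entry (++-index B-columns D-columns c))
    where
    top-entry : ∀ a s → [ lookupᵥ (lookup B a) , lookupᵥ (replicate n false) ]′ s ≡ block-entry s (inj₁ a)
    top-entry a (inj₁ u) = refl
    top-entry a (inj₂ v) = lookup-replicate v false
    bottom-entry : ∀ b s → [ lookupᵥ (replicate k true) , lookupᵥ (lookup D b) ]′ s ≡ block-entry s (inj₂ b)
    bottom-entry b (inj₁ u) = lookup-replicate u true
    bottom-entry b (inj₂ v) = refl
    column-entry : ∀ s → lookupᵥ ([ lookup B-columns , lookup D-columns ]′ s) r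
                         ≡ block-entry (splitAt k r) (unmap-index s)
    column-entry (inj₁ a) = begin
      lookupᵥ (lookup B-columns a) r
        ≡⟨ cong (flip lookupᵥ r) (lookup-map zeros-below B a) ⟩
      lookupᵥ (zeros-below (lookup B a′)) r
        ≡⟨ lookup-splitAt k (lookup B a′) (replicate n false) r ⟩
      [ lookupᵥ (lookup B a′) , lookupᵥ (replicate n false) ]′ (splitAt k r)
        ≡⟨ top-entry a′ (splitAt k r) ⟩
      block-entry (splitAt k r) (inj₁ a′) ∎
      where a′ = cast (length-map zeros-below B) a
    column-entry (inj₂ b) = begin
      lookupᵥ (lookup D-columns b) r
        ≡⟨ cong (flip lookupᵥ r) (lookup-map ones-above D b) ⟩
      lookupᵥ (ones-above (lookup D b′)) r
        ≡⟨ lookup-splitAt k (replicate k true) (lookup D b′) r ⟩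
      [ lookupᵥ (replicate k true) , lookupᵥ (lookup D b′) ]′ (splitAt k r)
        ≡⟨ bottom-entry b′ (splitAt k r) ⟩
      block-entry (splitAt k r) (inj₂ b′) ∎
      where b′ = cast (length-map ones-above D) b

  stack-entry-at : ∀ {r c s t} → splitAt k r ≡ s → stack-column c ≡ t → entry stack r c ≡ block-entry s t
  stack-entry-at {r} {c} er ec = trans (stack-entry r c) (cong₂ block-entry er ec)

  upper-rows-dominate : ∀ {r r′ u v} → splitAt k r ≡ inj₁ u → splitAt k r′ ≡ inj₂ v →
    ∀ c → entry stack r′ c ≤ entry stack r c
  upper-rows-dominate {u = u} {v} er er′ c =
    subst₂ _≤_ (sym (stack-entry-at er′ refl)) (sym (stack-entry-at er refl)) (block-dominates (stack-column c))
    where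
    block-dominates : ∀ t → block-entry (inj₂ v) t ≤ block-entry (inj₁ u) t
    block-dominates (inj₁ a) = ≤-minimum (entry B u a)
    block-dominates (inj₂ b) = ≤-maximum (entry D v b)

  cols-stack : cols stack ≡ cols B + cols D
  cols-stack =
    trans (length-++ B-columns) (cong₂ _+_ (length-map zeros-below B) (length-map ones-above D))

module _ {k m m′ : ℕ} {F : Mat k} {A : Mat m} {A′ : Mat m′} where

  -- A′ sits inside A: σ, ι locate its rows and τ, κ its columns
  ≺-restrict : {R C : Set} {σ : Fin m → R} {ι : Fin m′ → R} {τ : Fin (cols A) → C} {κ : Fin (cols A′) → C} →
    Injective _≡_ _≡_ σ → Injective _≡_ _≡_ τ →
    (∀ {r c r′ c′} → σ r ≡ ι r′ → τ c ≡ κ c′ → entry A r c ≡ entry A′ r′ c′) →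
    (e : F ≺ A) → let ρ = proj₁ e; γ = proj₁ (proj₂ (proj₂ e)) in
    (∀ i → ∃ λ r′ → σ (ρ i) ≡ ι r′) → (∀ j → ∃ λ c′ → τ (γ j) ≡ κ c′) →
    F ≺ A′
  ≺-restrict {ι = ι} {κ = κ} σ-inj τ-inj restrict (ρ , ρ-inj , γ , γ-inj , E) ρ′ γ′ =
    proj₁ ∘ ρ′ , ρ′-inj , proj₁ ∘ γ′ , γ′-inj , E′
    where
    ρ′-inj : Injective _≡_ _≡_ (proj₁ ∘ ρ′)
    ρ′-inj {x} {y} h = ρ-inj (σ-inj (trans (proj₂ (ρ′ x)) (trans (cong ι h) (sym (proj₂ (ρ′ y))))))
    γ′-inj : Injective _≡_ _≡_ (proj₁ ∘ γ′)
    γ′-inj {x} {y} h = γ-inj (τ-inj (trans (proj₂ (γ′ x)) (trans (cong κ h) (sym (proj₂ (γ′ y))))))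
    E′ : ∀ i j → entry A′ (proj₁ (ρ′ i)) (proj₁ (γ′ j)) ≡ entry F i j
    E′ i j = trans (sym (restrict (proj₂ (ρ′ i)) (proj₂ (γ′ j)))) (E i j)

HasColumn : Mat 2 → Bool → Bool → Set
HasColumn F x y = ∃ λ j → entry F zero j ≡ x × entry F (suc zero) j ≡ y

module _ {F : Mat 2} where

  placement-not-dominated : ∀ {m} (A : Mat m) (ρ : Fin 2 → Fin m) (γ : Fin (cols F) → Fin (cols A)) →
    (∀ i j → entry A (ρ i) (γ j) ≡ entry F i j) →
    ∀ {i i′} → (∃ λ j → entry F i j ≡ false × entry F i′ j ≡ true) →
    ¬ (∀ c → entry A (ρ i′) c ≤ entry A (ρ i) c)
  placement-not-dominated A ρ γ E {i} {i′} (j , Fij , Fi′j) dominated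
    with subst₂ _≤_ (trans (E i′ j) Fi′j) (trans (E i j) Fij) (dominated (γ j))
  ... | ()

  module _ (nonconstant : ∀ j → entry F zero j ≢ entry F (suc zero) j)
           (has10 : HasColumn F true false) (has01 : HasColumn F false true) where

    ≺-stack⁻ : ∀ {k n} (B : Mat k) (D : Mat n) → F ≺ stack B D → F ≺ B ⊎ F ≺ D
    ≺-stack⁻ {k} B D e@(ρ , _ , γ , _ , E)
      with splitAt k (ρ zero) in e₀ | splitAt k (ρ (suc zero)) in e₁
    ... | inj₁ u₀ | inj₁ u₁ = inj₁ (≺-restrict {F = F} {A = stack B D} {A′ = B}
      (splitAt-injective k) (stack-column-injective B D) (stack-entry-at B D) e upper-rows upper-columns)
      where
      upper-rows : ∀ i → ∃ λ u → splitAt k (ρ i) ≡ inj₁ u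
      upper-rows zero       = u₀ , e₀
      upper-rows (suc zero) = u₁ , e₁
      upper-columns : ∀ j → ∃ λ a → stack-column B D (γ j) ≡ inj₁ a
      upper-columns j with stack-column B D (γ j) in ec
      ... | inj₁ a = a , refl
      ... | inj₂ b = ⊥-elim (nonconstant j (begin
        entry F zero j                         ≡⟨ E zero j ⟨
        entry (stack B D) (ρ zero) (γ j)       ≡⟨ stack-entry-at B D e₀ ec ⟩
        true                                   ≡⟨ stack-entry-at B D e₁ ec ⟨
        entry (stack B D) (ρ (suc zero)) (γ j) ≡⟨ E (suc zero) j ⟩
        entry F (suc zero) j                   ∎))
    ... | inj₂ v₀ | inj₂ v₁ = inj₂ (≺-restrict {F = F} {A = stack B D} {A′ = D}
      (splitAt-injective k) (stack-column-injective B D) (stack-entry-at B D) e lower-rows lower-columns)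
      where
      lower-rows : ∀ i → ∃ λ v → splitAt k (ρ i) ≡ inj₂ v
      lower-rows zero       = v₀ , e₀
      lower-rows (suc zero) = v₁ , e₁
      lower-columns : ∀ j → ∃ λ b → stack-column B D (γ j) ≡ inj₂ b
      lower-columns j with stack-column B D (γ j) in ec
      ... | inj₂ b = b , refl
      ... | inj₁ a = ⊥-elim (nonconstant j (begin
        entry F zero j                         ≡⟨ E zero j ⟨
        entry (stack B D) (ρ zero) (γ j)       ≡⟨ stack-entry-at B D e₀ ec ⟩
        false                                  ≡⟨ stack-entry-at B D e₁ ec ⟨
        entry (stack B D) (ρ (suc zero)) (γ j) ≡⟨ E (suc zero) j ⟩
        entry F (suc zero) j                   ∎))
    ... | inj₁ u₀ | inj₂ v₁ = ⊥-elim (placement-not-dominated (stack B D) ρ γ E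
      has01 (upper-rows-dominate B D e₀ e₁))
    ... | inj₂ v₀ | inj₁ u₁ = ⊥-elim (placement-not-dominated (stack B D) ρ γ E
      (Product.map₂ Product.swap has10) (upper-rows-dominate B D e₁ e₀))

    construct-avoids : ∀ t (k : Fin t → ℕ) (B : (i : Fin t) → Mat (k i)) →
      (∀ i → ¬ F ≺ B i) → ¬ F ≺ construct t k B
    construct-avoids zero    k B avoid (ρ , _) with ρ zero
    ... | ()
    construct-avoids (suc t) k B avoid e =
      [ avoid zero , construct-avoids t (k ∘ suc) (B ∘ suc) (avoid ∘ suc) ]′
        (≺-stack⁻ (B zero) (construct t (k ∘ suc) (B ∘ suc)) e)

stack-simple : ∀ {k n} {B : Mat k} {D : Mat n} → Simple B → Simple D →
  (∀ c → c ∈ B → c ≢ replicate k true) → Simple (stack B D)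
stack-simple {k} {n} {B} {D} B-simple D-simple no-ones =
  ++⁺ (map⁺ (++-injectiveˡ _ _) B-simple) (map⁺ (++-injectiveʳ (replicate k true) _) D-simple) disjoint
  where
  disjoint : ∀ {v} → ¬ (v ∈ B-columns B D × v ∈ D-columns B D)
  disjoint (v∈B , v∈D) with ∈-map⁻ (zeros-below B D) v∈B | ∈-map⁻ (ones-above B D) v∈D
  ... | c , c∈B , refl | d , _ , c0≡1d = no-ones c c∈B (++-injectiveˡ c (replicate k true) c0≡1d)

construct-simple : ∀ t (k : Fin t → ℕ) (B : (i : Fin t) → Mat (k i)) → (∀ i → Simple (B i)) →
  (∀ i → ∀ c → c ∈ B i → c ≢ replicate (k i) true) → Simple (construct t k B)
construct-simple zero    k B simple no-ones = All.[] AllPairs.∷ AllPairs.[]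
construct-simple (suc t) k B simple no-ones =
  stack-simple (simple zero) (construct-simple t (k ∘ suc) (B ∘ suc) (simple ∘ suc) (no-ones ∘ suc))
    (no-ones zero)

cols-construct : ∀ t (k : Fin t → ℕ) (B : (i : Fin t) → Mat (k i)) →
  cols (construct t k B) ≡ suc (∑ t (λ i → cols (B i)))
cols-construct zero    k B = refl
cols-construct (suc t) k B = begin
  cols (stack (B zero) rest)                         ≡⟨ cols-stack (B zero) rest ⟩
  cols (B zero) + cols rest                          ≡⟨ cong (cols (B zero) +_) (cols-construct t (k ∘ suc) (B ∘ suc)) ⟩
  cols (B zero) + suc (∑ t (λ i → cols (B (suc i)))) ≡⟨ +-suc (cols (B zero)) _ ⟩
  suc (∑ (suc t) (λ i → cols (B i)))                 ∎
  where rest = construct t (k ∘ suc) (B ∘ suc)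

F0p10-nonconstant : ∀ p j → entry (F0p10 p) zero j ≢ entry (F0p10 p) (suc zero) j
F0p10-nonconstant zero    zero    ()
F0p10-nonconstant (suc p) zero    ()
F0p10-nonconstant (suc p) (suc j) = F0p10-nonconstant p j

F0p10-has01 : ∀ p → HasColumn (F0p10 p) false true
F0p10-has01 zero    = zero , refl , refl
F0p10-has01 (suc p) = Product.map suc id (F0p10-has01 p)

F0p10-has10 : ∀ p → HasColumn (F0p10 (suc p)) true false
F0p10-has10 p = zero , refl , refl

lemma1 : (p t : ℕ) → p ≥ 1 → t ≥ 1 →
    (k : Fin t → ℕ) (B : (i : Fin t) → Mat (k i)) →
    (∀ i → Avoid (k i) (F0p10 p) (B i)) →
    (∀ i → ∀ c → c ∈ B i → c ≢ replicate (k i) true) →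
    Avoid (∑ t k) (F0p10 p) (construct t k B)
      × cols (construct t k B) ≡ suc (∑ t (λ i → cols (B i)))
lemma1 zero    t () _ k B avoid no-ones
lemma1 (suc p) t _  _ k B avoid no-ones =
  ( construct-simple t k B (proj₁ ∘ avoid) no-ones
  , construct-avoids (F0p10-nonconstant (suc p)) (F0p10-has10 p) (F0p10-has01 (suc p)) t k B (proj₂ ∘ avoid) )
  , cols-construct t k B
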